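{- Let $E=\{0,1,\dots,n\}$ and let $M$ be a loopless matroid of rank $r+1$ on $E$. For any nonempty proper flat $F$ of $M$ with $|F|=k$, we have $x_F\gamma_k=0$ in $A^*(M)$.
   Context: The Chow ring $A^*(M)$ (real coefficients) is $\mathbb{R}[x_F : F \text{ a nonempty proper flat of } M]$ modulo the ideal generated by all $x_{F_1}x_{F_2}$ with $F_1,F_2$ incomparable and all $\sum_{F\ni i}x_F-\sum_{F\ni j}x_F$ for $i,j\in E$. For $S\subseteq E$, $x_S$ means the generator if $S$ is a nonempty proper flat and $0$ otherwise. For $1\le k\le n$ the hypersimplex class is $\gamma_k=\sum_{S}\left(\min(|S|,k)-\frac{k}{n+1}|S|\right)x_S\in A^1(M)$, the sum over nonempty proper subsets $S\subsetneq E$. -}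

module Defs where

open import Data.Nat as ℕ using (ℕ; zero; suc; _≤_; _<_; _⊓_)
open import Data.Integer as ℤ using (ℤ; +_)
open import Data.Rational as ℚ using (ℚ; 0ℚ; 1ℚ)
open import Data.Fin using (Fin)
open import Data.Fin.Subset using (Subset; _⊆_; _∪_; _∩_; ∣_∣; ⁅_⁆; _∈_; _∉_; Nonempty; ⊤)
open import Data.Fin.Subset.Properties using (_∈?_)
open import Data.Vec using (_∷_; [])
open import Data.Bool using (true; false)
open import Data.List using (List; []; _∷_; map; _++_; foldr; filter)
open import Data.Product using (∃; _×_; Σ)
open import Relation.Nullary using (¬_)
open import Relation.Nullary.Decidable using (_×-dec_)
open import Relation.Binary.PropositionalEquality using (_≡_)

record Matroid (m : ℕ) : Set where
  field
    rk       : Subset m → ℕ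
    rk-bound : ∀ S → rk S ≤ ∣ S ∣
    rk-mono  : ∀ S T → S ⊆ T → rk S ≤ rk T
    rk-sub   : ∀ S T → rk (S ∪ T) ℕ.+ rk (S ∩ T) ≤ rk S ℕ.+ rk T
open Matroid public

rank : ∀ {m} → Matroid m → ℕ
rank M = rk M ⊤

Loopless : ∀ {m} → Matroid m → Set
Loopless {m} M = ∀ (i : Fin m) → rk M ⁅ i ⁆ ≡ 1

IsFlat : ∀ {m} → Matroid m → Subset m → Set
IsFlat {m} M F = ∀ (i : Fin m) → i ∉ F → rk M F < rk M (F ∪ ⁅ i ⁆)

Proper : ∀ {m} → Subset m → Set
Proper {m} F = ∃ λ (i : Fin m) → i ∉ F

NPFlat : ∀ {m} → Matroid m → Subset m → Set
NPFlat M F = Nonempty F × Proper F × IsFlat M F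

allSubsets : ∀ m → List (Subset m)
allSubsets zero = [] ∷ []
allSubsets (suc m) = map (true ∷_) (allSubsets m) ++ map (false ∷_) (allSubsets m)

-- Formal expressions: the free commutative ℚ-algebra syntax on generators x_S (S ⊆ E)
data Expr (m : ℕ) : Set where
  var  : Subset m → Expr m
  con  : ℚ → Expr m
  _⊕_  : Expr m → Expr m → Expr m
  _⊗_  : Expr m → Expr m → Expr m
  ⊝_   : Expr m → Expr m

infixl 6 _⊕_
infixl 7 _⊗_

Σe : ∀ {m} → List (Expr m) → Expr m
Σe = foldr _⊕_ (con 0ℚ)

-- Σ_{F ∋ i} x_F  (x_F is 0 when F is not a nonempty proper flat, by the relation `kill` below)
linSum : ∀ {m} → Fin m → Expr m
linSum {m} i = Σe (map var (filter (λ F → i ∈? F) (allSubsets m)))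

Incomparable : ∀ {m} → Subset m → Subset m → Set
Incomparable S T = ¬ (S ⊆ T) × ¬ (T ⊆ S)

-- The congruence defining A*(M) = ℚ[x_S] / I  (as a setoid).
data _≈⟨_⟩_ {m : ℕ} : Expr m → Matroid m → Expr m → Set where
  ≈refl  : ∀ {M a} → a ≈⟨ M ⟩ a
  ≈sym   : ∀ {M a b} → a ≈⟨ M ⟩ b → b ≈⟨ M ⟩ a
  ≈trans : ∀ {M a b c} → a ≈⟨ M ⟩ b → b ≈⟨ M ⟩ c → a ≈⟨ M ⟩ c
  ⊕-cong : ∀ {M a b c d} → a ≈⟨ M ⟩ b → c ≈⟨ M ⟩ d → (a ⊕ c) ≈⟨ M ⟩ (b ⊕ d)
  ⊗-cong : ∀ {M a b c d} → a ≈⟨ M ⟩ b → c ≈⟨ M ⟩ d → (a ⊗ c) ≈⟨ M ⟩ (b ⊗ d)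
  ⊝-cong : ∀ {M a b} → a ≈⟨ M ⟩ b → (⊝ a) ≈⟨ M ⟩ (⊝ b)
  ⊕-assoc  : ∀ {M a b c} → ((a ⊕ b) ⊕ c) ≈⟨ M ⟩ (a ⊕ (b ⊕ c))
  ⊕-comm   : ∀ {M a b} → (a ⊕ b) ≈⟨ M ⟩ (b ⊕ a)
  ⊕-idˡ    : ∀ {M a} → (con 0ℚ ⊕ a) ≈⟨ M ⟩ a
  ⊝-invˡ   : ∀ {M a} → ((⊝ a) ⊕ a) ≈⟨ M ⟩ con 0ℚ
  ⊗-assoc  : ∀ {M a b c} → ((a ⊗ b) ⊗ c) ≈⟨ M ⟩ (a ⊗ (b ⊗ c))
  ⊗-comm   : ∀ {M a b} → (a ⊗ b) ≈⟨ M ⟩ (b ⊗ a)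
  ⊗-idˡ    : ∀ {M a} → (con 1ℚ ⊗ a) ≈⟨ M ⟩ a
  distribˡ : ∀ {M a b c} → (a ⊗ (b ⊕ c)) ≈⟨ M ⟩ ((a ⊗ b) ⊕ (a ⊗ c))
  con-+    : ∀ {M p q} → (con p ⊕ con q) ≈⟨ M ⟩ con (p ℚ.+ q)
  con-*    : ∀ {M p q} → (con p ⊗ con q) ≈⟨ M ⟩ con (p ℚ.* q)
  kill     : ∀ {M S} → ¬ NPFlat M S → var S ≈⟨ M ⟩ con 0ℚ
  incomp   : ∀ {M F G} → NPFlat M F → NPFlat M G → Incomparable F G →
             (var F ⊗ var G) ≈⟨ M ⟩ con 0ℚ
  linear   : ∀ {M} (i j : Fin m) → linSum i ≈⟨ M ⟩ linSum j

NPSubset? : ∀ n → Subset (suc n) → Data.Bool.Bool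
NPSubset? n S = (0 ℕ.<ᵇ ∣ S ∣) Data.Bool.∧ (∣ S ∣ ℕ.<ᵇ suc n)
  where import Data.Bool

γcoef : ∀ n → ℕ → Subset (suc n) → ℚ
γcoef n k S = ((+ (∣ S ∣ ⊓ k)) ℚ./ 1) ℚ.- ((+ (k ℕ.* ∣ S ∣)) ℚ./ suc n)

γ : ∀ n → ℕ → Expr (suc n)
γ n k = Σe (map (λ S → con (γcoef n k S) ⊗ var S)
               (Data.List.filterᵇ (NPSubset? n) (allSubsets (suc n))))
  where import Data.List

{-# OPTIONS --safe #-}
-- Put α = Σ_{S ∋ i} x_S, which does not depend on i by the linear relations.  Double counting
-- pairs (i, S) with i ∈ G ∩ S gives Σ_S |G ∩ S| x_S = |G| α for every G ⊆ E, hence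
-- Σ_S (|F ∩ S| − k|S|/(n+1)) x_S = kα − kα = 0.  Multiplying by x_F kills x_S for S incomparable
-- to F, while for S comparable to F we have |F ∩ S| = min(|S|, k); as x_∅ = x_E = 0, what
-- remains is exactly x_F γ_k.
module Submission where

open import Defs hiding (_≈⟨_⟩_)
open import Level using (0ℓ)
open import Function using (_∘_; _$_)
open import Data.Bool using (Bool; true; false; if_then_else_; _∧_; T)
open import Data.Sum using (_⊎_; inj₁; inj₂)
open import Data.Product using (_,_; proj₁; proj₂)
open import Data.Nat as ℕ using (ℕ; zero; suc; _⊓_; s≤s)
import Data.Nat.Properties as ℕ
open import Data.Integer as ℤ using (+_)
import Data.Integer.Properties as ℤ
open import Data.Integer.Tactic.RingSolver using (solve-∀)
open import Data.Rational as ℚ using (ℚ; 0ℚ; fromℚᵘ; toℚᵘ)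
import Data.Rational.Properties as ℚ
open import Data.Rational.Unnormalised as ℚᵘ using (mkℚᵘ; *≡*)
import Data.Rational.Unnormalised.Properties as ℚᵘ
open import Data.Fin using (Fin; zero; suc)
import Data.Fin.Properties as Fin
open import Data.List using (List; []; _∷_; map; filter; length)
import Data.List as List
open import Data.Vec using ([]; _∷_; lookup)
open import Data.Vec.Properties using (lookup-zipWith)
open import Data.Fin.Subset using (Subset; _⊆_; _∩_; _∪_; ⁅_⁆; _∈_; ∣_∣; ⊤; Nonempty)
open import Data.Fin.Subset.Properties
  using (_∈?_; _⊆?_; nonempty?; ⊆-antisym; p∩q⊆p; p∩q⊆q; x∈p∩q⁺; ∩-identityˡ; ∈⊤; ∣⊤∣≡n;
         ∣p∣≤n; ∣p∣≡n⇒p≡⊤; p⊆q⇒∣p∣≤∣q∣; x∈p⇒∣p-x∣<∣p∣)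
open import Algebra.Bundles using (CommutativeRing)
open import Algebra.Morphism.Structures using (IsMonoidHomomorphism)
import Algebra.Morphism.Construct.Composition as Composition
import Algebra.Consequences.Setoid as Consequences
open import Relation.Nullary using (Dec; yes; no; does; ¬_)
open import Relation.Nullary.Decidable using (_×-dec_; _→-dec_; ¬?; T?)
open import Relation.Unary using (Pred; Decidable)
open import Relation.Binary.Bundles using (Setoid)
open import Relation.Binary.PropositionalEquality as ≡ using (_≡_; cong; cong₂)

fromℚᵘ-homo-+ : ∀ p q → fromℚᵘ (p ℚᵘ.+ q) ≡ fromℚᵘ p ℚ.+ fromℚᵘ q
fromℚᵘ-homo-+ p q = ℚ.toℚᵘ-injective $ begin
  toℚᵘ (fromℚᵘ (p ℚᵘ.+ q))              ≈⟨ ℚ.toℚᵘ-fromℚᵘ (p ℚᵘ.+ q) ⟩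
  p ℚᵘ.+ q                              ≈⟨ ℚᵘ.+-cong (ℚ.toℚᵘ-fromℚᵘ p) (ℚ.toℚᵘ-fromℚᵘ q) ⟨
  toℚᵘ (fromℚᵘ p) ℚᵘ.+ toℚᵘ (fromℚᵘ q)  ≈⟨ ℚ.toℚᵘ-homo-+ (fromℚᵘ p) (fromℚᵘ q) ⟨
  toℚᵘ (fromℚᵘ p ℚ.+ fromℚᵘ q)          ∎
  where open import Relation.Binary.Reasoning.Setoid ℚᵘ.≃-setoid

-- Written exactly as the second term of γcoef, which is therefore frac k n ∣ S ∣ by definition.
frac : ℕ → ℕ → ℕ → ℚ
frac k d c = (+ (k ℕ.* c)) ℚ./ suc d

frac-isMonoidHomomorphism : ∀ k d →
  IsMonoidHomomorphism ℕ.+-0-rawMonoid ℚ.+-0-rawMonoid (frac k d)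
frac-isMonoidHomomorphism k d = record
  { isMagmaHomomorphism = record
    { isRelHomomorphism = record { cong = cong (frac k d) }
    ; homo              = homo
    }
  ; ε-homo = ℚ.fromℚᵘ-cong {mkℚᵘ (+ (k ℕ.* 0)) d} {mkℚᵘ (+ 0) 0}
               (*≡* (cong (λ x → + x ℤ.* + 1) (ℕ.*-zeroʳ k)))
  }
  where
  homo : ∀ a b → frac k d (a ℕ.+ b) ≡ frac k d a ℚ.+ frac k d b
  homo a b = ≡.trans (ℚ.fromℚᵘ-cong {mkℚᵘ (+ (k ℕ.* (a ℕ.+ b))) d} {p ℚᵘ.+ q} (*≡* cross))
                     (fromℚᵘ-homo-+ p q)
    where
    p = mkℚᵘ (+ (k ℕ.* a)) d
    q = mkℚᵘ (+ (k ℕ.* b)) d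
    D = + suc d
    distrib : ∀ k a b D → (k ℤ.* (a ℤ.+ b)) ℤ.* (D ℤ.* D) ≡ (k ℤ.* a ℤ.* D ℤ.+ k ℤ.* b ℤ.* D) ℤ.* D
    distrib = solve-∀
    cross : + (k ℕ.* (a ℕ.+ b)) ℤ.* (D ℤ.* D) ≡ (+ (k ℕ.* a) ℤ.* D ℤ.+ + (k ℕ.* b) ℤ.* D) ℤ.* D
    cross = begin
      + (k ℕ.* (a ℕ.+ b)) ℤ.* (D ℤ.* D)
        ≡⟨ cong (ℤ._* (D ℤ.* D)) (≡.trans (ℤ.pos-* k (a ℕ.+ b)) (cong (+ k ℤ.*_) (ℤ.pos-+ a b))) ⟩
      (+ k ℤ.* (+ a ℤ.+ + b)) ℤ.* (D ℤ.* D)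
        ≡⟨ distrib (+ k) (+ a) (+ b) D ⟩
      (+ k ℤ.* + a ℤ.* D ℤ.+ + k ℤ.* + b ℤ.* D) ℤ.* D
        ≡⟨ cong₂ (λ x y → (x ℤ.* D ℤ.+ y ℤ.* D) ℤ.* D) (ℤ.pos-* k a) (ℤ.pos-* k b) ⟨
      (+ (k ℕ.* a) ℤ.* D ℤ.+ + (k ℕ.* b) ℤ.* D) ℤ.* D ∎
      where open ≡.≡-Reasoning

frac-cancel : ∀ k d → frac k d (suc d) ≡ (+ k) ℚ./ 1
frac-cancel k d = ℚ.fromℚᵘ-cong {mkℚᵘ (+ (k ℕ.* suc d)) d} {mkℚᵘ (+ k) 0}
  (*≡* (≡.trans (ℤ.*-identityʳ _) (ℤ.pos-* k (suc d))))

frac-one : ∀ c → frac 1 0 c ≡ (+ c) ℚ./ 1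
frac-one c = cong (λ x → (+ x) ℚ./ 1) (ℕ.*-identityˡ c)

module DoubleCounting {c ℓ} (R : CommutativeRing c ℓ) where
  open CommutativeRing R
  open import Algebra.Properties.Semiring.Sum semiring
  open import Algebra.Properties.CommutativeSemigroup *-commutativeSemigroup using (interchange)
  open import Relation.Binary.Reasoning.Setoid setoid

  𝟙 : Bool → Carrier
  𝟙 b = if b then 1# else 0#

  𝟙-∧ : ∀ a b → 𝟙 (a ∧ b) ≈ 𝟙 a * 𝟙 b
  𝟙-∧ false b = sym (zeroˡ (𝟙 b))
  𝟙-∧ true  b = sym (*-identityˡ (𝟙 b))

  module _ {W : ℕ → Carrier} (W-homo : IsMonoidHomomorphism ℕ.+-0-rawMonoid +-rawMonoid W) where
    open IsMonoidHomomorphism W-homo using (homo; ε-homo)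

    W-∣∣ : ∀ {m} (T : Subset m) → W ∣ T ∣ ≈ ∑[ i < m ] (𝟙 (lookup T i) * W 1)
    W-∣∣ []          = ε-homo
    W-∣∣ (true ∷ T)  = trans (homo 1 ∣ T ∣) (+-cong (sym (*-identityˡ (W 1))) (W-∣∣ T))
    W-∣∣ (false ∷ T) = trans (W-∣∣ T) (sym (trans (+-congʳ (zeroˡ (W 1))) (+-identityˡ _)))

    ∑-W-∣∩∣ : ∀ {m k} (G : Subset m) (S : Fin k → Subset m) (x : Fin k → Carrier) →
              ∑[ j < k ] (W ∣ G ∩ S j ∣ * x j) ≈
              ∑[ i < m ] (𝟙 (lookup G i) * W 1 * ∑[ j < k ] (𝟙 (lookup (S j) i) * x j))
    ∑-W-∣∩∣ {m} {k} G S x = begin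
      ∑[ j < k ] (W ∣ G ∩ S j ∣ * x j)
        ≈⟨ sum-cong-≋ {k} (λ j → *-congʳ (W-∣∣ (G ∩ S j))) ⟩
      ∑[ j < k ] ((∑[ i < m ] (𝟙 (lookup (G ∩ S j) i) * W 1)) * x j)
        ≈⟨ sum-cong-≋ {k} (λ j → *-distribʳ-sum {m} (x j) _) ⟩
      ∑[ j < k ] ∑[ i < m ] (𝟙 (lookup (G ∩ S j) i) * W 1 * x j)
        ≈⟨ ∑-comm {k} {m} _ ⟩
      ∑[ i < m ] ∑[ j < k ] (𝟙 (lookup (G ∩ S j) i) * W 1 * x j)
        ≈⟨ sum-cong-≋ {m} (λ i → sum-cong-≋ {k} (λ j → split i j)) ⟩
      ∑[ i < m ] ∑[ j < k ] (𝟙 (lookup G i) * W 1 * (𝟙 (lookup (S j) i) * x j))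
        ≈⟨ sum-cong-≋ {m} (λ i → *-distribˡ-sum {k} _ _) ⟨
      ∑[ i < m ] (𝟙 (lookup G i) * W 1 * ∑[ j < k ] (𝟙 (lookup (S j) i) * x j)) ∎
      where
      split : ∀ i j → 𝟙 (lookup (G ∩ S j) i) * W 1 * x j ≈
                      𝟙 (lookup G i) * W 1 * (𝟙 (lookup (S j) i) * x j)
      split i j = begin
        𝟙 (lookup (G ∩ S j) i) * W 1 * x j
          ≈⟨ *-congʳ (*-congʳ (reflexive (cong 𝟙 (lookup-zipWith _∧_ i G (S j))))) ⟩
        𝟙 (lookup G i ∧ lookup (S j) i) * W 1 * x j
          ≈⟨ *-congʳ (*-congʳ (𝟙-∧ _ _)) ⟩
        𝟙 (lookup G i) * 𝟙 (lookup (S j) i) * W 1 * x j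
          ≈⟨ *-assoc _ _ _ ⟩
        𝟙 (lookup G i) * 𝟙 (lookup (S j) i) * (W 1 * x j)
          ≈⟨ interchange _ _ _ _ ⟩
        𝟙 (lookup G i) * W 1 * (𝟙 (lookup (S j) i) * x j) ∎

does-∈? : ∀ {m} (i : Fin m) (p : Subset m) → does (i ∈? p) ≡ lookup p i
does-∈? zero    (true  ∷ p) = ≡.refl
does-∈? zero    (false ∷ p) = ≡.refl
does-∈? (suc i) (_     ∷ p) = does-∈? i p

comparable⇒∣∩∣≡⊓ : ∀ {m} {F S : Subset m} → S ⊆ F ⊎ F ⊆ S → ∣ F ∩ S ∣ ≡ ∣ S ∣ ⊓ ∣ F ∣
comparable⇒∣∩∣≡⊓ {F = F} {S} (inj₁ S⊆F) =
  ≡.trans (cong ∣_∣ (⊆-antisym (p∩q⊆q F S) (λ x∈S → x∈p∩q⁺ (S⊆F x∈S , x∈S))))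
          (≡.sym (ℕ.m≤n⇒m⊓n≡m (p⊆q⇒∣p∣≤∣q∣ S⊆F)))
comparable⇒∣∩∣≡⊓ {F = F} {S} (inj₂ F⊆S) =
  ≡.trans (cong ∣_∣ (⊆-antisym (p∩q⊆p F S) (λ x∈F → x∈p∩q⁺ (x∈F , F⊆S x∈F))))
          (≡.sym (ℕ.m≥n⇒m⊓n≡n (p⊆q⇒∣p∣≤∣q∣ F⊆S)))

∣p∣≡0⇒¬Nonempty : ∀ {m} {p : Subset m} → ∣ p ∣ ≡ 0 → ¬ Nonempty p
∣p∣≡0⇒¬Nonempty ∣p∣≡0 (x , x∈p) = ℕ.m<n⇒n≢0 (x∈p⇒∣p-x∣<∣p∣ x∈p) ∣p∣≡0

NPSubset?-false : ∀ n (S : Subset (suc n)) → NPSubset? n S ≡ false → ∣ S ∣ ≡ 0 ⊎ ∣ S ∣ ≡ suc n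
NPSubset?-false n S = go ∣ S ∣ (∣p∣≤n S)
  where
  go : ∀ s → s ℕ.≤ suc n → ((0 ℕ.<ᵇ s) ∧ (s ℕ.<ᵇ suc n)) ≡ false → s ≡ 0 ⊎ s ≡ suc n
  go zero    _         _  = inj₁ ≡.refl
  go (suc s) (s≤s s≤n) eq = inj₂ (cong suc (ℕ.≤∧≮⇒≡ s≤n (λ s<n → ≡.subst T eq (ℕ.<⇒<ᵇ s<n))))

npFlat? : ∀ {m} (M : Matroid m) → Decidable (NPFlat M)
npFlat? M S = nonempty? S ×-dec Fin.any? (λ i → ¬? (i ∈? S))
                          ×-dec Fin.all? (λ i → ¬? (i ∈? S) →-dec (rk M S ℕ.<? rk M (S ∪ ⁅ i ⁆)))

module _ {m : ℕ} (M : Matroid m) where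
  open Defs using (_≈⟨_⟩_)

  private
    ≈-setoid : Setoid 0ℓ 0ℓ
    ≈-setoid = record
      { Carrier       = Expr m
      ; _≈_           = _≈⟨ M ⟩_
      ; isEquivalence = record { refl = ≈refl ; sym = ≈sym ; trans = ≈trans }
      }

    ⊕-comm′ : ∀ a b → (a ⊕ b) ≈⟨ M ⟩ (b ⊕ a)
    ⊕-comm′ a b = ⊕-comm

    ⊗-comm′ : ∀ a b → (a ⊗ b) ≈⟨ M ⟩ (b ⊗ a)
    ⊗-comm′ a b = ⊗-comm

    open Consequences ≈-setoid

  chowRing : CommutativeRing 0ℓ 0ℓ
  chowRing = record
    { Carrier = Expr m
    ; _≈_     = _≈⟨ M ⟩_
    ; _+_     = _⊕_
    ; _*_     = _⊗_
    ; -_      = ⊝_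
    ; 0#      = con 0ℚ
    ; 1#      = con ℚ.1ℚ
    ; isCommutativeRing = record
      { isRing = record
        { +-isAbelianGroup = record
          { isGroup = record
            { isMonoid = record
              { isSemigroup = record
                { isMagma = record { isEquivalence = Setoid.isEquivalence ≈-setoid ; ∙-cong = ⊕-cong }
                ; assoc   = λ a b c → ⊕-assoc {a = a} {b} {c}
                }
              ; identity = comm∧idˡ⇒id ⊕-comm′ (λ a → ⊕-idˡ {a = a})
              }
            ; inverse = comm∧invˡ⇒inv ⊕-comm′ (λ a → ⊝-invˡ {a = a})
            ; ⁻¹-cong = ⊝-cong
            }
          ; comm = ⊕-comm′
          }
        ; *-cong     = ⊗-cong
        ; *-assoc    = λ a b c → ⊗-assoc {a = a} {b} {c}
        ; *-identity = comm∧idˡ⇒id ⊗-comm′ (λ a → ⊗-idˡ {a = a})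
        ; distrib    = comm∧distrˡ⇒distr ⊕-cong ⊗-comm′ (λ a b c → distribˡ {a = a} {b} {c})
        }
      ; *-comm = ⊗-comm′
      }
    }

module ChowRing {m : ℕ} (M : Matroid m) where
  open CommutativeRing (chowRing M)
  open import Algebra.Properties.Semiring.Sum semiring
  open import Algebra.Properties.Group +-group using (identityˡ-unique)
  open import Relation.Binary.Reasoning.Setoid setoid
  open DoubleCounting (chowRing M)

  ∑ₛ : (Subset m → Carrier) → Carrier
  ∑ₛ f = ∑[ j < length (allSubsets m) ] f (List.lookup (allSubsets m) j)

  Σe-map : ∀ {A : Set} (xs : List A) (f : A → Carrier) →
           Σe (map f xs) ≡ ∑[ j < length xs ] f (List.lookup xs j)
  Σe-map []       f = ≡.refl
  Σe-map (x ∷ xs) f = cong (f x ⊕_) (Σe-map xs f)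

  Σe-filter : ∀ {A : Set} {p} {P : Pred A p} (P? : Decidable P) (xs : List A) (f : A → Carrier) →
              Σe (map f (filter P? xs)) ≈ Σe (map (λ x → 𝟙 (does (P? x)) * f x) xs)
  Σe-filter P? []       f = refl
  Σe-filter P? (x ∷ xs) f with does (P? x)
  ... | true  = +-cong (sym (*-identityˡ (f x))) (Σe-filter P? xs f)
  ... | false = trans (Σe-filter P? xs f) (sym (trans (+-congʳ (zeroˡ (f x))) (+-identityˡ _)))

  linSum≈∑ₛ : ∀ i → linSum i ≈ ∑ₛ (λ S → 𝟙 (lookup S i) * var S)
  linSum≈∑ₛ i = trans (Σe-filter (i ∈?_) (allSubsets m) var) (reflexive (≡.trans
    (Σe-map (allSubsets m) (λ S → 𝟙 (does (i ∈? S)) * var S))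
    (sum-cong-≗ (λ j → cong (λ b → 𝟙 b * var (List.lookup (allSubsets m) j))
                             (does-∈? i (List.lookup (allSubsets m) j))))))

  con-isMonoidHomomorphism : IsMonoidHomomorphism ℚ.+-0-rawMonoid +-rawMonoid con
  con-isMonoidHomomorphism = record
    { isMagmaHomomorphism = record
      { isRelHomomorphism = record { cong = reflexive ∘ cong con }
      ; homo              = λ p q → sym con-+
      }
    ; ε-homo = refl
    }

  ∑ₛ-W-∣∩∣ : ∀ {W : ℕ → Carrier} → IsMonoidHomomorphism ℕ.+-0-rawMonoid +-rawMonoid W →
             ∀ (G : Subset m) (i : Fin m) → ∑ₛ (λ S → W ∣ G ∩ S ∣ * var S) ≈ W ∣ G ∣ * linSum i
  ∑ₛ-W-∣∩∣ {W} W-homo G i = begin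
    ∑ₛ (λ S → W ∣ G ∩ S ∣ * var S)
      ≈⟨ ∑-W-∣∩∣ W-homo G (List.lookup (allSubsets m)) (var ∘ List.lookup (allSubsets m)) ⟩
    ∑[ j < m ] (𝟙 (lookup G j) * W 1 * ∑ₛ (λ S → 𝟙 (lookup S j) * var S))
      ≈⟨ sum-cong-≋ {m} (λ j → *-congˡ (trans (sym (linSum≈∑ₛ j)) (linear j i))) ⟩
    ∑[ j < m ] (𝟙 (lookup G j) * W 1 * linSum i)
      ≈⟨ *-distribʳ-sum {m} (linSum i) _ ⟨
    (∑[ j < m ] (𝟙 (lookup G j) * W 1)) * linSum i
      ≈⟨ *-congʳ (W-∣∣ W-homo G) ⟨
    W ∣ G ∣ * linSum i ∎

  ∑ₛ-∣∩∣-cancel : ∀ {w w′ : ℕ → ℚ} →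
                  IsMonoidHomomorphism ℕ.+-0-rawMonoid ℚ.+-0-rawMonoid w →
                  IsMonoidHomomorphism ℕ.+-0-rawMonoid ℚ.+-0-rawMonoid w′ →
                  ∀ (G G′ : Subset m) (i : Fin m) → w ∣ G ∣ ≡ w′ ∣ G′ ∣ →
                  ∑ₛ (λ S → con (w (∣ G ∩ S ∣) ℚ.- w′ (∣ G′ ∩ S ∣)) * var S) ≈ 0#
  ∑ₛ-∣∩∣-cancel {w} {w′} w-homo w′-homo G G′ i w∣G∣≡w′∣G′∣ = identityˡ-unique _ _ $ begin
    ∑ₛ (λ S → con (a S ℚ.- b S) * var S) + ∑ₛ (λ S → con (b S) * var S)
      ≈⟨ ∑-distrib-+ {length (allSubsets m)} _ _ ⟨
    ∑ₛ (λ S → con (a S ℚ.- b S) * var S + con (b S) * var S)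
      ≈⟨ sum-cong-≋ {length (allSubsets m)} (λ j → recombine (List.lookup (allSubsets m) j)) ⟩
    ∑ₛ (λ S → con (a S) * var S)
      ≈⟨ ∑ₛ-W-∣∩∣ (W-homo w-homo) G i ⟩
    con (w ∣ G ∣) * linSum i
      ≈⟨ *-congʳ (reflexive (cong con w∣G∣≡w′∣G′∣)) ⟩
    con (w′ ∣ G′ ∣) * linSum i
      ≈⟨ ∑ₛ-W-∣∩∣ (W-homo w′-homo) G′ i ⟨
    ∑ₛ (λ S → con (b S) * var S) ∎
    where
    a b : Subset m → ℚ
    a S = w ∣ G ∩ S ∣
    b S = w′ ∣ G′ ∩ S ∣
    W-homo : ∀ {u} → IsMonoidHomomorphism ℕ.+-0-rawMonoid ℚ.+-0-rawMonoid u →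
             IsMonoidHomomorphism ℕ.+-0-rawMonoid +-rawMonoid (con ∘ u)
    W-homo u-homo = Composition.isMonoidHomomorphism trans u-homo con-isMonoidHomomorphism
    recombine : ∀ S → con (a S ℚ.- b S) * var S + con (b S) * var S ≈ con (a S) * var S
    recombine S = begin
      con (a S ℚ.- b S) * var S + con (b S) * var S  ≈⟨ distribʳ (var S) _ _ ⟨
      (con (a S ℚ.- b S) + con (b S)) * var S        ≈⟨ *-congʳ con-+ ⟩
      con (a S ℚ.- b S ℚ.+ b S) * var S             ≈⟨ *-congʳ (reflexive (cong con (ℚ-cancel _ _))) ⟩
      con (a S) * var S                             ∎
      where
      ℚ-cancel : ∀ p q → p ℚ.- q ℚ.+ q ≡ p
      ℚ-cancel p q = ≡.trans (ℚ.+-assoc p (ℚ.- q) q)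
                             (≡.trans (cong (p ℚ.+_) (ℚ.+-inverseˡ q)) (ℚ.+-identityʳ p))

  var-incomparable : ∀ {F S} → NPFlat M F → Incomparable F S → var F * var S ≈ 0#
  var-incomparable {F} {S} npF F∥S with npFlat? M S
  ... | yes npS  = incomp npF npS F∥S
  ... | no  ¬npS = trans (*-congˡ (kill ¬npS)) (zeroʳ (var F))

  var-∅-or-E : ∀ {S} → ∣ S ∣ ≡ 0 ⊎ ∣ S ∣ ≡ m → var S ≈ 0#
  var-∅-or-E (inj₁ ∣S∣≡0) = kill (∣p∣≡0⇒¬Nonempty ∣S∣≡0 ∘ proj₁)
  var-∅-or-E (inj₂ ∣S∣≡m) = kill λ npS → let (i , i∉S) = proj₁ (proj₂ npS) in
    i∉S (≡.subst (i ∈_) (≡.sym (∣p∣≡n⇒p≡⊤ ∣S∣≡m)) ∈⊤)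

module Hypersimplex {n : ℕ} (M : Matroid (suc n)) where
  open CommutativeRing (chowRing M) hiding (zero)
  open import Algebra.Properties.Semiring.Sum semiring
  open import Algebra.Properties.CommutativeSemigroup *-commutativeSemigroup using (x∙yz≈y∙xz)
  open import Relation.Binary.Reasoning.Setoid setoid
  open DoubleCounting (chowRing M) using (𝟙)
  open ChowRing M

  γ≈∑ₛ : ∀ k → γ n k ≈ ∑ₛ (λ S → 𝟙 (NPSubset? n S) * (con (γcoef n k S) * var S))
  γ≈∑ₛ k = trans (Σe-filter (T? ∘ NPSubset? n) (allSubsets (suc n)) (λ S → con (γcoef n k S) * var S))
                 (reflexive (Σe-map (allSubsets (suc n)) _))

  module _ {F : Subset (suc n)} (npF : NPFlat M F) where
    k : ℕ
    k = ∣ F ∣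

    -- γcoef with min(|S|, k) replaced by |F ∩ S|: it agrees with γcoef on S comparable to F.
    coefficient : Subset (suc n) → ℚ
    coefficient S = frac 1 0 (∣ F ∩ S ∣) ℚ.- frac k n (∣ ⊤ ∩ S ∣)

    ∑ₛ-coefficient≈0 : ∑ₛ (λ S → con (coefficient S) * var S) ≈ 0#
    ∑ₛ-coefficient≈0 =
      ∑ₛ-∣∩∣-cancel (frac-isMonoidHomomorphism 1 0) (frac-isMonoidHomomorphism k n) F ⊤ zero k/1≡k[n+1]/[n+1]
      where
      k/1≡k[n+1]/[n+1] : frac 1 0 ∣ F ∣ ≡ frac k n ∣ ⊤ {suc n} ∣
      k/1≡k[n+1]/[n+1] = ≡.trans (frac-one k)
                           (≡.trans (≡.sym (frac-cancel k n)) (cong (frac k n) (≡.sym (∣⊤∣≡n (suc n)))))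

    var-*-γ-term : ∀ S → var F * (𝟙 (NPSubset? n S) * (con (γcoef n k S) * var S)) ≈
                         var F * (con (coefficient S) * var S)
    var-*-γ-term S with NPSubset? n S in np
    ... | false = trans (trans (*-congˡ (zeroˡ _)) (zeroʳ _))
                        (sym (trans (*-congˡ (trans (*-congˡ x_S≈0) (zeroʳ _))) (zeroʳ _)))
      where
      x_S≈0 : var S ≈ 0#
      x_S≈0 = var-∅-or-E (NPSubset?-false n S np)
    ... | true  = trans (*-congˡ (*-identityˡ _)) (by-comparability (S ⊆? F) (F ⊆? S))
      where
      comparable : S ⊆ F ⊎ F ⊆ S →
                   var F * (con (γcoef n k S) * var S) ≈ var F * (con (coefficient S) * var S)
      comparable S∼F = *-congˡ (*-congʳ (reflexive (cong con (cong₂ ℚ._-_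
        (≡.trans (cong (λ c → (+ c) ℚ./ 1) (≡.sym (comparable⇒∣∩∣≡⊓ S∼F))) (≡.sym (frac-one ∣ F ∩ S ∣)))
        (cong (frac k n ∘ ∣_∣) (≡.sym (∩-identityˡ S)))))))
      incomparable : ∀ c → Incomparable F S → var F * (con c * var S) ≈ 0#
      incomparable c F∥S = trans (x∙yz≈y∙xz _ _ _) (trans (*-congˡ (var-incomparable npF F∥S)) (zeroʳ _))
      by-comparability : Dec (S ⊆ F) → Dec (F ⊆ S) →
                         var F * (con (γcoef n k S) * var S) ≈ var F * (con (coefficient S) * var S)
      by-comparability (yes S⊆F) _         = comparable (inj₁ S⊆F)
      by-comparability (no _)    (yes F⊆S) = comparable (inj₂ F⊆S)
      by-comparability (no S⊈F)  (no F⊈S)  =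
        trans (incomparable _ (F⊈S , S⊈F)) (sym (incomparable _ (F⊈S , S⊈F)))

    var-*-γ≈0 : var F * γ n k ≈ 0#
    var-*-γ≈0 = begin
      var F * γ n k
        ≈⟨ *-congˡ (γ≈∑ₛ k) ⟩
      var F * ∑ₛ (λ S → 𝟙 (NPSubset? n S) * (con (γcoef n k S) * var S))
        ≈⟨ *-distribˡ-sum {length (allSubsets (suc n))} _ _ ⟩
      ∑ₛ (λ S → var F * (𝟙 (NPSubset? n S) * (con (γcoef n k S) * var S)))
        ≈⟨ sum-cong-≋ {length (allSubsets (suc n))} (var-*-γ-term ∘ List.lookup (allSubsets (suc n))) ⟩
      ∑ₛ (λ S → var F * (con (coefficient S) * var S))
        ≈⟨ *-distribˡ-sum {length (allSubsets (suc n))} _ _ ⟨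
      var F * ∑ₛ (λ S → con (coefficient S) * var S)
        ≈⟨ *-congˡ ∑ₛ-coefficient≈0 ⟩
      var F * 0#
        ≈⟨ zeroʳ _ ⟩
      0# ∎

open Defs using (_≈⟨_⟩_)

corollary2p7 : (n r : ℕ) (M : Matroid (suc n)) → Loopless M → rank M ≡ suc r →
               (F : Subset (suc n)) → NPFlat M F →
               (var F ⊗ γ n ∣ F ∣) ≈⟨ M ⟩ con 0ℚ
corollary2p7 n r M _ _ F npF = Hypersimplex.var-*-γ≈0 M npF
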